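{- Consider a matroid whose ground set is partitioned into a set $K$ of elements with known weights and a set $U$ of elements with unknown weights, where all weights are pairwise distinct and strictly positive. Let $I^*_K \subseteq K$ be the maximum-weight independent subset of $K$. For a weight vector $w \in \mathbb{R}^{|U|}$ for the elements of $U$ (keeping all weights pairwise distinct and positive), let $I_w \subseteq I^*_K$ be the set of elements of $I^*_K$ that are not contained in the maximum-weight basis of the matroid once the weights $w$ are revealed. Then the set $\mathcal{K} = \bigcup_{w} I_w$ has cardinality at most $\min(|U|, |I^*_K|)$.
   Formalization: All weights, both the known weights on K and the revealed weights w in the union defining $\mathcal{K}$, are rational instead of real. -}

module Defs where

open import Level using (0ℓ)
open import Data.Nat using (ℕ; zero; suc) renaming (_<_ to _<ℕ_)
open import Data.Fin using (Fin; zero; suc)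
open import Data.Fin.Subset using (Subset; _∈_; _∉_; _⊆_; _∪_; ⁅_⁆; ⊥; ∣_∣)
open import Data.Vec using ([]; _∷_)
open import Data.Bool using (true; false)
open import Data.Rational using (ℚ; 0ℚ; _+_; _<_; _≤_)
open import Data.Product using (_×_; ∃)
open import Relation.Nullary using (¬_)
open import Relation.Binary.PropositionalEquality using (_≡_)

record Matroid (n : ℕ) : Set₁ where
  field
    Indep    : Subset n → Set
    indep-∅  : Indep ⊥
    indep-⊆  : ∀ {A B} → B ⊆ A → Indep A → Indep B
    exchange : ∀ {A B} → Indep A → Indep B → ∣ A ∣ <ℕ ∣ B ∣ →
               ∃ λ x → x ∈ B × x ∉ A × Indep (A ∪ ⁅ x ⁆)
open Matroid public

weight : ∀ {n} → (Fin n → ℚ) → Subset n → ℚ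
weight {zero}  w []            = 0ℚ
weight {suc n} w (true  ∷ S)   = w zero + weight (λ i → w (suc i)) S
weight {suc n} w (false ∷ S)   = weight (λ i → w (suc i)) S

IsMaxWeightIndepIn : ∀ {n} → Matroid n → (Fin n → ℚ) → Subset n → Subset n → Set
IsMaxWeightIndepIn M w K I =
  I ⊆ K × Indep M I × (∀ J → J ⊆ K → Indep M J → weight w J ≤ weight w I)

IsBasis : ∀ {n} → Matroid n → Subset n → Set
IsBasis M B = Indep M B × (∀ x → x ∉ B → ¬ Indep M (B ∪ ⁅ x ⁆))

IsMaxWeightBasis : ∀ {n} → Matroid n → (Fin n → ℚ) → Subset n → Set
IsMaxWeightBasis M w B = IsBasis M B × (∀ B′ → IsBasis M B′ → weight w B′ ≤ weight w B)

Completion : ∀ {n} → Subset n → (Fin n → ℚ) → (Fin n → ℚ) → Set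
Completion K wK w =
  (∀ i → i ∈ K → w i ≡ wK i) × (∀ i → 0ℚ < w i) × (∀ i j → w i ≡ w j → i ≡ j)

InUnionIw : ∀ {n} → Matroid n → Subset n → (Fin n → ℚ) → Subset n → Fin n → Set
InUnionIw M K wK I e =
  e ∈ I × ∃ λ w → Completion K wK w × ∃ λ B → IsMaxWeightBasis M w B × e ∉ B

{-# OPTIONS --safe #-}
module Submission where

-- Write U = ∁ K. If a maximum-weight basis B for a completion w omits e ∈ I, then the elements
-- of B heavier than e span e (a greedy exchange argument). Each of them is unknown, lies in I
-- above e, or is a known element outside I, which the elements of I above it span by the same
-- argument applied to I inside K. So every e ∈ 𝒦 is spanned by U and the elements of I heavier
-- than e, and descending induction along I shows that U ∪ (I ∖ 𝒦) spans the independent set I.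
-- Hence |I| ≤ |U| + |I ∖ 𝒦|, that is |𝒦| ≤ |U|; and 𝒦 ⊆ I.

open import Defs
open import Data.Nat using (ℕ; zero; suc; _≤_; _⊓_; z≤n; s≤s; _≤?_) renaming (_+_ to _+ℕ_)
import Data.Nat.Properties as ℕ
open import Data.Fin using (Fin; zero; suc)
open import Data.Fin.Properties using (any?)
open import Data.Fin.Subset using (Subset; _∈_; _∉_; _⊆_; _⊂_; _⊃_; _∪_; _∩_; ∁; ⁅_⁆; ⊥; ⊤; ∣_∣)
open import Data.Fin.Subset.Properties
open import Data.Fin.Subset.Induction using (⊂-wellFounded; ⊃-wellFounded)
open import Data.Vec using ([]; _∷_; lookup; tabulate; here; there)
open import Data.Vec.Properties using (lookup∘tabulate; []=⇒lookup; lookup⇒[]=)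
open import Data.Bool using (true; false)
open import Data.Bool.Properties using (T-≡)
open import Data.Rational using (ℚ; 0ℚ; _<_; _+_; _<?_) renaming (_≤_ to _≤ℚ_)
import Data.Rational.Properties as ℚ
open import Algebra.Bundles using (CommutativeMonoid)
open import Algebra.Properties.CommutativeSemigroup
  (CommutativeMonoid.commutativeSemigroup ℚ.+-0-commutativeMonoid) using (x∙yz≈y∙xz)
open import Data.Product using (_×_; _,_; ∃; proj₁; proj₂)
open import Data.Sum using (_⊎_; inj₁; inj₂; [_,_]; map₂)
open import Function using (_∘_; _on_; Equivalence)
open import Induction.WellFounded using (Acc; acc)
import Relation.Binary.Construct.On as On
open import Relation.Binary.Definitions using (tri<; tri≈; tri>)
open import Relation.Binary.PropositionalEquality
  using (_≡_; _≢_; refl; sym; trans; cong; cong₂; subst; subst₂; module ≡-Reasoning)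
open import Relation.Nullary using (¬_; yes; no; does; contradiction)
open import Relation.Nullary.Decidable
  using (_×-dec_; ¬?; isYes; isYes≗does; decidable-stable; ¬¬-excluded-middle; dec-true; toWitness)
open import Relation.Unary using (Decidable)

private
  variable
    n : ℕ
    x y : Fin n
    p q r : Subset n

∪-lub : p ⊆ r → q ⊆ r → p ∪ q ⊆ r
∪-lub {p = p} {q = q} p⊆r q⊆r = [ p⊆r , q⊆r ] ∘ x∈p∪q⁻ p q

x∈p⇒⁅x⁆⊆p : x ∈ p → ⁅ x ⁆ ⊆ p
x∈p⇒⁅x⁆⊆p {x = x} x∈p z∈⁅x⁆ rewrite x∈⁅y⁆⇒x≡y x z∈⁅x⁆ = x∈p

x∈p∪⁅y⁆⁻ : ∀ (p : Subset n) y → x ∈ p ∪ ⁅ y ⁆ → x ∈ p ⊎ x ≡ y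
x∈p∪⁅y⁆⁻ p y = map₂ (x∈⁅y⁆⇒x≡y y) ∘ x∈p∪q⁻ p ⁅ y ⁆

x∉p⇒p⊂p∪⁅x⁆ : x ∉ p → p ⊂ p ∪ ⁅ x ⁆
x∉p⇒p⊂p∪⁅x⁆ {x = x} x∉p = p⊆p∪q _ , x , q⊆p∪q _ _ (x∈⁅x⁆ x) , x∉p

p⊆q∪⁅x⁆⇒p∩∁q≡⁅x⁆ : p ⊆ q ∪ ⁅ x ⁆ → x ∈ p → x ∉ q → p ∩ ∁ q ≡ ⁅ x ⁆
p⊆q∪⁅x⁆⇒p∩∁q≡⁅x⁆ {p = p} {q = q} {x = x} p⊆q∪x x∈p x∉q = ⊆-antisym ⊆⁅x⁆ (x∈p⇒⁅x⁆⊆p x∈p∩∁q)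
  where
  x∈p∩∁q : x ∈ p ∩ ∁ q
  x∈p∩∁q = x∈p∩q⁺ (x∈p , x∉p⇒x∈∁p x∉q)
  ⊆⁅x⁆ : p ∩ ∁ q ⊆ ⁅ x ⁆
  ⊆⁅x⁆ z∈ with x∈p∩q⁻ p (∁ q) z∈
  ... | z∈p , z∈∁q with x∈p∪⁅y⁆⁻ q x (p⊆q∪x z∈p)
  ...   | inj₁ z∈q = contradiction z∈q (x∈∁p⇒x∉p z∈∁q)
  ...   | inj₂ refl = x∈⁅x⁆ x

∣p∪q∣≤∣p∣+∣q∣ : ∀ (p q : Subset n) → ∣ p ∪ q ∣ ≤ ∣ p ∣ +ℕ ∣ q ∣
∣p∪q∣≤∣p∣+∣q∣ []          []          = z≤n
∣p∪q∣≤∣p∣+∣q∣ (true  ∷ p) (b     ∷ q) =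
  s≤s (ℕ.≤-trans (∣p∪q∣≤∣p∣+∣q∣ p q) (ℕ.+-monoʳ-≤ ∣ p ∣ (∣p∣≤∣x∷p∣ b q)))
∣p∪q∣≤∣p∣+∣q∣ (false ∷ p) (true  ∷ q) =
  ℕ.≤-trans (s≤s (∣p∪q∣≤∣p∣+∣q∣ p q)) (ℕ.≤-reflexive (sym (ℕ.+-suc _ _)))
∣p∪q∣≤∣p∣+∣q∣ (false ∷ p) (false ∷ q) = ∣p∪q∣≤∣p∣+∣q∣ p q

∣p∣≡∣p∩q∣+∣p∩∁q∣ : ∀ (p q : Subset n) → ∣ p ∣ ≡ ∣ p ∩ q ∣ +ℕ ∣ p ∩ ∁ q ∣
∣p∣≡∣p∩q∣+∣p∩∁q∣ []          []          = refl
∣p∣≡∣p∩q∣+∣p∩∁q∣ (false ∷ p) (_     ∷ q) = ∣p∣≡∣p∩q∣+∣p∩∁q∣ p q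
∣p∣≡∣p∩q∣+∣p∩∁q∣ (true  ∷ p) (true  ∷ q) = cong suc (∣p∣≡∣p∩q∣+∣p∩∁q∣ p q)
∣p∣≡∣p∩q∣+∣p∩∁q∣ (true  ∷ p) (false ∷ q) =
  trans (cong suc (∣p∣≡∣p∩q∣+∣p∩∁q∣ p q)) (sym (ℕ.+-suc _ _))

∣p∣≤∣q∣⇒∣p∩∁q∣≤∣q∩∁p∣ : ∀ (p q : Subset n) → ∣ p ∣ ≤ ∣ q ∣ → ∣ p ∩ ∁ q ∣ ≤ ∣ q ∩ ∁ p ∣
∣p∣≤∣q∣⇒∣p∩∁q∣≤∣q∩∁p∣ p q ∣p∣≤∣q∣ = ℕ.+-cancelˡ-≤ ∣ p ∩ q ∣ _ _ (begin
  ∣ p ∩ q ∣ +ℕ ∣ p ∩ ∁ q ∣  ≡⟨ sym (∣p∣≡∣p∩q∣+∣p∩∁q∣ p q) ⟩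
  ∣ p ∣                     ≤⟨ ∣p∣≤∣q∣ ⟩
  ∣ q ∣                     ≡⟨ ∣p∣≡∣p∩q∣+∣p∩∁q∣ q p ⟩
  ∣ q ∩ p ∣ +ℕ ∣ q ∩ ∁ p ∣  ≡⟨ cong (λ s → ∣ s ∣ +ℕ ∣ q ∩ ∁ p ∣) (∩-comm q p) ⟩
  ∣ p ∩ q ∣ +ℕ ∣ q ∩ ∁ p ∣  ∎)
  where open ℕ.≤-Reasoning

¬¬-decidable : (P : Subset n → Set) → ¬ ¬ Decidable P
¬¬-decidable {zero}  P k = ¬¬-excluded-middle λ P[]? → k λ { [] → P[]? }
¬¬-decidable {suc n} P k =
  ¬¬-decidable (P ∘ (true ∷_)) λ P₁? → ¬¬-decidable (P ∘ (false ∷_)) λ P₀? →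
    k λ { (true ∷ A) → P₁? A ; (false ∷ A) → P₀? A }

≤∧≢⇒< : ∀ {s t} → s ≤ℚ t → s ≢ t → s < t
≤∧≢⇒< {s} {t} s≤t s≢t with ℚ.<-cmp s t
... | tri< s<t _ _ = s<t
... | tri≈ _ s≡t _ = contradiction s≡t s≢t
... | tri> _ _ t<s = contradiction (ℚ.<-≤-trans t<s s≤t) (ℚ.<-irrefl refl)

weight-split : ∀ (w : Fin n → ℚ) (p q : Subset n) →
  weight w p ≡ weight w (p ∩ q) + weight w (p ∩ ∁ q)
weight-split {zero}  w []          []          = sym (ℚ.+-identityʳ 0ℚ)
weight-split {suc n} w (false ∷ p) (_     ∷ q) = weight-split (w ∘ suc) p q
weight-split {suc n} w (true  ∷ p) (true  ∷ q) =
  trans (cong (w zero +_) (weight-split (w ∘ suc) p q)) (sym (ℚ.+-assoc (w zero) _ _))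
weight-split {suc n} w (true  ∷ p) (false ∷ q) =
  trans (cong (w zero +_) (weight-split (w ∘ suc) p q))
        (x∙yz≈y∙xz (w zero) (weight (w ∘ suc) (p ∩ q)) (weight (w ∘ suc) (p ∩ ∁ q)))

weight-∣p∣≡0 : ∀ (w : Fin n → ℚ) (p : Subset n) → ∣ p ∣ ≡ 0 → weight w p ≡ 0ℚ
weight-∣p∣≡0 {zero}  w []          _ = refl
weight-∣p∣≡0 {suc n} w (false ∷ p) e = weight-∣p∣≡0 (w ∘ suc) p e

weight-⁅x⁆ : ∀ (w : Fin n → ℚ) x → weight w ⁅ x ⁆ ≡ w x
weight-⁅x⁆ {suc n} w zero    =
  trans (cong (w zero +_) (weight-∣p∣≡0 (w ∘ suc) ⊥ (∣⊥∣≡0 n))) (ℚ.+-identityʳ _)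
weight-⁅x⁆ {suc n} w (suc x) = weight-⁅x⁆ (w ∘ suc) x

∣p∣≤1⇒weight< : ∀ (w : Fin n → ℚ) (p : Subset n) {c} →
  ∣ p ∣ ≤ 1 → (∀ {x} → x ∈ p → w x < c) → 0ℚ < c → weight w p < c
∣p∣≤1⇒weight< {zero}  w []          _         _     0<c = 0<c
∣p∣≤1⇒weight< {suc n} w (false ∷ p) ∣p∣≤1     below 0<c =
  ∣p∣≤1⇒weight< (w ∘ suc) p ∣p∣≤1 (below ∘ there) 0<c
∣p∣≤1⇒weight< {suc n} w (true  ∷ p) (s≤s ∣p∣≤0) below 0<c = subst (_< _)
  (sym (trans (cong (w zero +_) (weight-∣p∣≡0 (w ∘ suc) p (ℕ.n≤0⇒n≡0 ∣p∣≤0))) (ℚ.+-identityʳ _)))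
  (below here)

-- S arises from B by adding y and removing at most one element, which is lighter than y.
weight-exchange : ∀ (w : Fin n → ℚ) {B S : Subset n} {y} →
  S ⊆ B ∪ ⁅ y ⁆ → y ∈ S → y ∉ B → ∣ B ∣ ≤ ∣ S ∣ →
  (∀ {g} → g ∈ B → g ∉ S → w g < w y) → 0ℚ < w y → weight w B < weight w S
weight-exchange w {B} {S} {y} S⊆B∪y y∈S y∉B ∣B∣≤∣S∣ lighter 0<wy = begin-strict
  weight w B                              ≡⟨ weight-split w B S ⟩
  weight w (B ∩ S) + weight w (B ∩ ∁ S)   <⟨ ℚ.+-monoʳ-< (weight w (B ∩ S)) B─S-lighter ⟩
  weight w (B ∩ S) + w y                  ≡⟨ cong₂ _+_ (cong (weight w) (∩-comm B S)) (sym (weight-⁅x⁆ w y)) ⟩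
  weight w (S ∩ B) + weight w ⁅ y ⁆       ≡⟨ cong (λ s → weight w (S ∩ B) + weight w s) (sym S∩∁B≡⁅y⁆) ⟩
  weight w (S ∩ B) + weight w (S ∩ ∁ B)   ≡⟨ sym (weight-split w S B) ⟩
  weight w S                              ∎
  where
  open ℚ.≤-Reasoning
  S∩∁B≡⁅y⁆ : S ∩ ∁ B ≡ ⁅ y ⁆
  S∩∁B≡⁅y⁆ = p⊆q∪⁅x⁆⇒p∩∁q≡⁅x⁆ S⊆B∪y y∈S y∉B
  ∣B─S∣≤1 : ∣ B ∩ ∁ S ∣ ≤ 1
  ∣B─S∣≤1 = subst (∣ B ∩ ∁ S ∣ ≤_) (trans (cong ∣_∣ S∩∁B≡⁅y⁆) (∣⁅x⁆∣≡1 y))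
                  (∣p∣≤∣q∣⇒∣p∩∁q∣≤∣q∩∁p∣ B S ∣B∣≤∣S∣)
  B─S-lighter : weight w (B ∩ ∁ S) < w y
  B─S-lighter = ∣p∣≤1⇒weight< w (B ∩ ∁ S) ∣B─S∣≤1
    (λ g∈ → let g∈B , g∈∁S = x∈p∩q⁻ B (∁ S) g∈ in lighter g∈B (x∈∁p⇒x∉p g∈∁S)) 0<wy

above : (Fin n → ℚ) → ℚ → Subset n
above w t = tabulate λ x → isYes (t <? w x)

∈-above⁺ : ∀ {w : Fin n → ℚ} {t x} → t < w x → x ∈ above w t
∈-above⁺ {w = w} {t} {x} t<wx = lookup⇒[]= x _ (begin
  lookup (above w t) x  ≡⟨ lookup∘tabulate _ x ⟩
  isYes (t <? w x)      ≡⟨ isYes≗does (t <? w x) ⟩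
  does (t <? w x)       ≡⟨ dec-true (t <? w x) t<wx ⟩
  true                  ∎)
  where open ≡-Reasoning

∈-above⁻ : ∀ {w : Fin n → ℚ} {t x} → x ∈ above w t → t < w x
∈-above⁻ {w = w} {t} {x} x∈ =
  toWitness {a? = t <? w x} (Equivalence.from T-≡ (trans (sym (lookup∘tabulate _ x)) ([]=⇒lookup x∈)))

module MatroidTheory (M : Matroid n) where

  IsBasisOf : Subset n → Subset n → Set
  IsBasisOf X Z = Indep M Z × Z ⊆ X × (∀ {y} → y ∈ X → y ∉ Z → ¬ Indep M (Z ∪ ⁅ y ⁆))

  Spans : Subset n → Fin n → Set
  Spans X x = x ∈ X ⊎ ∃ λ A → Indep M A × A ⊆ X × ¬ Indep M (A ∪ ⁅ x ⁆)

  spans-mono : ∀ {X X′ x} → X ⊆ X′ → Spans X x → Spans X′ x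
  spans-mono X⊆X′ (inj₁ x∈X)                  = inj₁ (X⊆X′ x∈X)
  spans-mono X⊆X′ (inj₂ (A , indA , A⊆X , dep)) = inj₂ (A , indA , X⊆X′ ∘ A⊆X , dep)

  basisOf-maximum : ∀ {X Z J} → IsBasisOf X Z → Indep M J → J ⊆ X → ∣ J ∣ ≤ ∣ Z ∣
  basisOf-maximum (indZ , _ , maximal) indJ J⊆X = ℕ.≮⇒≥ λ ∣Z∣<∣J∣ →
    let y , y∈J , y∉Z , indZy = exchange M indZ indJ ∣Z∣<∣J∣ in maximal (J⊆X y∈J) y∉Z indZy

  ∣B∣≤∣S∣⇒isBasis : ∀ {B S} → IsBasis M B → Indep M S → ∣ B ∣ ≤ ∣ S ∣ → IsBasis M S
  ∣B∣≤∣S∣⇒isBasis (indB , maximalB) indS ∣B∣≤∣S∣ = indS , λ x x∉S indSx →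
    let ∣B∣<∣Sx∣ = ℕ.≤-<-trans ∣B∣≤∣S∣ (p⊂q⇒∣p∣<∣q∣ (x∉p⇒p⊂p∪⁅x⁆ x∉S))
        z , _ , z∉B , indBz = exchange M indB indSx ∣B∣<∣Sx∣
    in maximalB z z∉B indBz

  module _ (indep? : Decidable (Indep M)) where

    extendToBasisOf : ∀ {X A} → Acc _⊃_ A → Indep M A → A ⊆ X → ∃ λ Z → A ⊆ Z × IsBasisOf X Z
    extendToBasisOf {X} {A} (acc rec) indA A⊆X
      with any? (λ y → y ∈? X ×-dec ¬? (y ∈? A) ×-dec indep? (A ∪ ⁅ y ⁆))
    ... | no ¬augmentable =
      A , ⊆-refl , indA , A⊆X , λ y∈X y∉A indAy → ¬augmentable (_ , y∈X , y∉A , indAy)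
    ... | yes (y , y∈X , y∉A , indAy) =
      let Z , A∪y⊆Z , basisZ =
            extendToBasisOf (rec (x∉p⇒p⊂p∪⁅x⁆ y∉A)) indAy (∪-lub A⊆X (x∈p⇒⁅x⁆⊆p y∈X))
      in Z , A∪y⊆Z ∘ p⊆p∪q _ , basisZ

    basisOf-exists : ∀ X → ∃ (IsBasisOf X)
    basisOf-exists X =
      let Z , _ , basisZ = extendToBasisOf (⊃-wellFounded ⊥) (indep-∅ M) ⊥⊆ in Z , basisZ

    -- Extend A to a basis Q of A ∪ Z ∪ {y}: then |Q| > |Z|, yet y ∉ Q puts Q inside X.
    basisOf-dependent : ∀ {X Z y} → IsBasisOf X Z → Spans X y → y ∉ Z → ¬ Indep M (Z ∪ ⁅ y ⁆)
    basisOf-dependent (_ , _ , maximal) (inj₁ y∈X) y∉Z = maximal y∈X y∉Z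
    basisOf-dependent {X} {Z} {y} basisZ@(_ , Z⊆X , _) (inj₂ (A , indA , A⊆X , depAy)) y∉Z indZy
      with extendToBasisOf (⊃-wellFounded _) indA (p⊆p∪q {p = A} (Z ∪ ⁅ y ⁆))
    ... | Q , A⊆Q , basisQ@(indQ , Q⊆A∪Z∪y , _) =
      ℕ.<-irrefl refl (begin-strict
        ∣ Z ∣          <⟨ p⊂q⇒∣p∣<∣q∣ (x∉p⇒p⊂p∪⁅x⁆ y∉Z) ⟩
        ∣ Z ∪ ⁅ y ⁆ ∣  ≤⟨ basisOf-maximum basisQ indZy (q⊆p∪q A _) ⟩
        ∣ Q ∣          ≤⟨ basisOf-maximum basisZ indQ Q⊆X ⟩
        ∣ Z ∣          ∎)
      where
      open ℕ.≤-Reasoning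
      y∉Q : y ∉ Q
      y∉Q y∈Q = depAy (indep-⊆ M (∪-lub A⊆Q (x∈p⇒⁅x⁆⊆p y∈Q)) indQ)
      Q⊆X : Q ⊆ X
      Q⊆X x∈Q with x∈p∪q⁻ A (Z ∪ ⁅ y ⁆) (Q⊆A∪Z∪y x∈Q)
      ... | inj₁ x∈A = A⊆X x∈A
      ... | inj₂ x∈Z∪y with x∈p∪⁅y⁆⁻ Z y x∈Z∪y
      ...   | inj₁ x∈Z = Z⊆X x∈Z
      ...   | inj₂ refl = contradiction x∈Q y∉Q

    basisOf-∪ : ∀ {X Y Z} → IsBasisOf X Z → (∀ {y} → y ∈ Y → Spans X y) → IsBasisOf (X ∪ Y) Z
    basisOf-∪ {X} {Y} basisZ@(indZ , Z⊆X , _) Y⊲X =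
      indZ , p⊆p∪q Y ∘ Z⊆X , λ y∈X∪Y → basisOf-dependent basisZ ([ inj₁ , Y⊲X ] (x∈p∪q⁻ X Y y∈X∪Y))

    spans-trans : ∀ {X Y x} → Spans Y x → (∀ {y} → y ∈ Y → Spans X y) → Spans X x
    spans-trans {X} {Y} {x} Y⊲x Y⊲X with x ∈? X
    ... | yes x∈X = inj₁ x∈X
    ... | no  x∉X =
      let Z , basisZ@(indZ , Z⊆X , _) = basisOf-exists X
      in inj₂ (Z , indZ , Z⊆X ,
               basisOf-dependent (basisOf-∪ basisZ Y⊲X) (spans-mono (q⊆p∪q X Y) Y⊲x) (x∉X ∘ Z⊆X))

    ∣indep∣≤∣spanning∣ : ∀ {X J} → Indep M J → (∀ {y} → y ∈ J → Spans X y) → ∣ J ∣ ≤ ∣ X ∣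
    ∣indep∣≤∣spanning∣ {X} indJ J⊲X =
      let Z , basisZ@(_ , Z⊆X , _) = basisOf-exists X
      in ℕ.≤-trans (basisOf-maximum (basisOf-∪ basisZ J⊲X) indJ (q⊆p∪q X _)) (p⊆q⇒∣p∣≤∣q∣ Z⊆X)

    -- If the heavier part of B together with y were independent, augmenting it from B would
    -- exchange y for at most one lighter element of B.
    spannedByHeavier : ∀ {R B y} (w : Fin n → ℚ) → Indep M B → B ⊆ R →
      (∀ S → Indep M S → S ⊆ R → ∣ B ∣ ≤ ∣ S ∣ → weight w S ≤ℚ weight w B) →
      (∀ i j → i ∈ R → j ∈ R → w i ≡ w j → i ≡ j) →
      y ∈ R → y ∉ B → 0ℚ < w y → Spans (B ∩ above w (w y)) y
    spannedByHeavier {R} {B} {y} w indB B⊆R optimal injective y∈R y∉B 0<wy =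
      inj₂ (B ∩ above w (w y) , indep-⊆ M (p∩q⊆p B _) indB , ⊆-refl , dependent)
      where
      dependent : ¬ Indep M ((B ∩ above w (w y)) ∪ ⁅ y ⁆)
      dependent indHy
        with extendToBasisOf (⊃-wellFounded _) indHy (∪-lub (p⊆p∪q _ ∘ p∩q⊆p B _) (q⊆p∪q B _))
      ... | S , Hy⊆S , basisS@(indS , S⊆B∪y , _) =
        ℚ.<-irrefl refl (ℚ.<-≤-trans (weight-exchange w S⊆B∪y y∈S y∉B ∣B∣≤∣S∣ lighter 0<wy)
                                      (optimal S indS (∪-lub B⊆R (x∈p⇒⁅x⁆⊆p y∈R) ∘ S⊆B∪y) ∣B∣≤∣S∣))
        where
        ∣B∣≤∣S∣ : ∣ B ∣ ≤ ∣ S ∣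
        ∣B∣≤∣S∣ = basisOf-maximum basisS indB (p⊆p∪q _)
        y∈S : y ∈ S
        y∈S = Hy⊆S (q⊆p∪q _ _ (x∈⁅x⁆ y))
        lighter : ∀ {g} → g ∈ B → g ∉ S → w g < w y
        lighter g∈B g∉S =
          ≤∧≢⇒< (ℚ.≮⇒≥ λ wy<wg → g∉S (Hy⊆S (p⊆p∪q _ (x∈p∩q⁺ (g∈B , ∈-above⁺ wy<wg)))))
                λ wg≡wy → y∉B (subst (_∈ B) (injective _ _ (B⊆R g∈B) y∈R wg≡wy) g∈B)

module _ (M : Matroid n) (K : Subset n) (wK : Fin n → ℚ)
         (posK : ∀ i → i ∈ K → 0ℚ < wK i)
         (distK : ∀ i j → i ∈ K → j ∈ K → wK i ≡ wK j → i ≡ j)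
         (I : Subset n) (maxI : IsMaxWeightIndepIn M wK K I)
         (indep? : Decidable (Indep M)) where

  open MatroidTheory M

  private
    I⊆K : I ⊆ K
    I⊆K = proj₁ maxI
    indI : Indep M I
    indI = proj₁ (proj₂ maxI)

  heavier : Fin n → Subset n
  heavier e = I ∩ above wK (wK e)

  heavier-⊆ : ∀ {e y} → wK e < wK y → heavier y ⊆ heavier e
  heavier-⊆ {e} {y} e<y x∈ =
    let x∈I , x∈above = x∈p∩q⁻ I (above wK (wK y)) x∈
    in x∈p∩q⁺ (x∈I , ∈-above⁺ (ℚ.<-trans e<y (∈-above⁻ x∈above)))

  known-spannedByHeavier : ∀ {e y} → y ∈ K → wK e < wK y → Spans (heavier e) y
  known-spannedByHeavier {e} {y} y∈K e<y with y ∈? I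
  ... | yes y∈I = inj₁ (x∈p∩q⁺ (y∈I , ∈-above⁺ e<y))
  ... | no  y∉I = spans-mono (heavier-⊆ e<y)
    (spannedByHeavier indep? wK indI I⊆K (λ S indS S⊆K _ → proj₂ (proj₂ maxI) S S⊆K indS)
                      distK y∈K y∉I (posK y y∈K))

  inUnionIw-spanned : ∀ {e} → InUnionIw M K wK I e → Spans (∁ K ∪ heavier e) e
  inUnionIw-spanned {e} (e∈I , w , (agree , pos , inj) , B , (basisB@(indB , _) , optB) , e∉B) =
    spans-trans indep?
      (spannedByHeavier indep? w indB (λ _ → ∈⊤) optimal (λ i j _ _ → inj i j) ∈⊤ e∉B (pos e))
      heavierInB-spanned
    where
    optimal : ∀ S → Indep M S → S ⊆ ⊤ → ∣ B ∣ ≤ ∣ S ∣ → weight w S ≤ℚ weight w B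
    optimal S indS _ ∣B∣≤∣S∣ = optB S (∣B∣≤∣S∣⇒isBasis basisB indS ∣B∣≤∣S∣)
    heavierInB-spanned : ∀ {y} → y ∈ B ∩ above w (w e) → Spans (∁ K ∪ heavier e) y
    heavierInB-spanned {y} y∈ with y ∈? K
    ... | no  y∉K = inj₁ (p⊆p∪q _ (x∉p⇒x∈∁p y∉K))
    ... | yes y∈K = spans-mono (q⊆p∪q (∁ K) _) (known-spannedByHeavier y∈K
      (subst₂ _<_ (agree e (I⊆K e∈I)) (agree y y∈K) (∈-above⁻ (proj₂ (x∈p∩q⁻ B _ y∈)))))

  module _ (𝒦 : Subset n) (𝒦⊆⋃Iw : ∀ {e} → e ∈ 𝒦 → InUnionIw M K wK I e) where

    I-spannedBy : ∀ {e} → Acc (_⊂_ on heavier) e → e ∈ I → Spans (∁ K ∪ (I ∩ ∁ 𝒦)) e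
    I-spannedBy {e} (acc rec) e∈I with e ∈? 𝒦
    ... | no  e∉𝒦 = inj₁ (q⊆p∪q (∁ K) _ (x∈p∩q⁺ (e∈I , x∉p⇒x∈∁p e∉𝒦)))
    ... | yes e∈𝒦 = spans-trans indep? (inUnionIw-spanned (𝒦⊆⋃Iw e∈𝒦))
                      λ y∈ → [ inj₁ ∘ p⊆p∪q _ , heavier-spanned ] (x∈p∪q⁻ (∁ K) (heavier e) y∈)
      where
      heavier-spanned : ∀ {y} → y ∈ heavier e → Spans (∁ K ∪ (I ∩ ∁ 𝒦)) y
      heavier-spanned {y} y∈ =
        let y∈I , y∈above = x∈p∩q⁻ I _ y∈
            y∉heavier-y = λ y∈′ → ℚ.<-irrefl refl (∈-above⁻ (proj₂ (x∈p∩q⁻ I _ y∈′)))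
        in I-spannedBy (rec (heavier-⊆ (∈-above⁻ y∈above) , y , y∈ , y∉heavier-y)) y∈I

    ∣𝒦∣≤∣∁K∣⊓∣I∣ : ∣ 𝒦 ∣ ≤ ∣ ∁ K ∣ ⊓ ∣ I ∣
    ∣𝒦∣≤∣∁K∣⊓∣I∣ = ℕ.⊓-glb (ℕ.+-cancelʳ-≤ ∣ I ∩ ∁ 𝒦 ∣ _ _ counting) (p⊆q⇒∣p∣≤∣q∣ 𝒦⊆I)
      where
      open ℕ.≤-Reasoning
      𝒦⊆I : 𝒦 ⊆ I
      𝒦⊆I = proj₁ ∘ 𝒦⊆⋃Iw
      counting : ∣ 𝒦 ∣ +ℕ ∣ I ∩ ∁ 𝒦 ∣ ≤ ∣ ∁ K ∣ +ℕ ∣ I ∩ ∁ 𝒦 ∣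
      counting = begin
        ∣ 𝒦 ∣ +ℕ ∣ I ∩ ∁ 𝒦 ∣      ≤⟨ ℕ.+-monoˡ-≤ _ (p⊆q⇒∣p∣≤∣q∣ λ e∈𝒦 → x∈p∩q⁺ (𝒦⊆I e∈𝒦 , e∈𝒦)) ⟩
        ∣ I ∩ 𝒦 ∣ +ℕ ∣ I ∩ ∁ 𝒦 ∣  ≡⟨ sym (∣p∣≡∣p∩q∣+∣p∩∁q∣ I 𝒦) ⟩
        ∣ I ∣                     ≤⟨ ∣indep∣≤∣spanning∣ indep? indI
                                      (I-spannedBy (On.wellFounded heavier ⊂-wellFounded _)) ⟩
        ∣ ∁ K ∪ (I ∩ ∁ 𝒦) ∣        ≤⟨ ∣p∪q∣≤∣p∣+∣q∣ (∁ K) _ ⟩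
        ∣ ∁ K ∣ +ℕ ∣ I ∩ ∁ 𝒦 ∣     ∎

proposition12 : ∀ {n} (M : Matroid n) (K : Subset n) (wK : Fin n → ℚ) →
    (∀ i → i ∈ K → 0ℚ < wK i) →
    (∀ i j → i ∈ K → j ∈ K → wK i ≡ wK j → i ≡ j) →
    (I : Subset n) → IsMaxWeightIndepIn M wK K I →
    (𝒦 : Subset n) → (∀ e → (e ∈ 𝒦 → InUnionIw M K wK I e) × (InUnionIw M K wK I e → e ∈ 𝒦)) →
    ∣ 𝒦 ∣ ≤ ∣ ∁ K ∣ ⊓ ∣ I ∣
-- Independence need not be decidable, but the goal is, so decidability may be assumed.
proposition12 M K wK posK distK I maxI 𝒦 𝒦≡⋃Iw =
  decidable-stable (∣ 𝒦 ∣ ≤? ∣ ∁ K ∣ ⊓ ∣ I ∣) λ bound-fails →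
    ¬¬-decidable (Indep M) λ indep? →
      bound-fails (∣𝒦∣≤∣∁K∣⊓∣I∣ M K wK posK distK I maxI indep? 𝒦 (proj₁ (𝒦≡⋃Iw _)))
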